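{- Let $G$ be a finite Abelian group of exponent $n=q_1^{\alpha_1}\cdots q_\ell^{\alpha_\ell}$ with primes $q_1<\cdots<q_\ell$ and $\alpha_j\geq1$, and let $S$ be a sequence over $G$ containing no tiny zero-sum subsequence. Then, for all $i \in \{1,\dots,\ell\}$, $$\sum_{d \in \mathcal{A}_i } k_d \leq \mathsf{t}\left(G_{q_i^{\nu_{q_i}(n)}}\right)-1.$$
   Context: $G$ is written additively; for $m\mid n$, $G_m=\{x\in G: mx=0\}$. A sequence over $G$ (or over a subset) is a finite multiset of elements; subsequences are sub-multisets; $|S|$ is the length and $\sigma(S)$ the sum. The cross number is $\mathsf{k}(S)=\sum_{g\in S}1/\mathrm{ord}(g)$ (with multiplicity). A tiny zero-sum subsequence of $S$ is a non-empty subsequence $S'$ with $\sigma(S')=0$ and $\mathsf{k}(S')\leq1$. For a finite Abelian group $H$, $\mathsf{t}(H)$ is the smallest positive integer $t$ such that every sequence over $H$ of length at least $t$ contains a tiny zero-sum subsequence. For $d\mid n$, $S_d$ is the subsequence of $S$ of all elements of order exactly $d$. $P^+(d)$ is the largest prime divisor of $d$ and $\nu_p$ the $p$-adic valuation. $\mathcal{A}_i=\{d\mid n: d>1,\ P^+(d)=q_i\}$. For $d'\mid d\mid n$, $\eta_{(d',d)}(G)$ is the smallest positive integer $t$ such that every sequence over $G_d$ of length at least $t$ contains a non-empty subsequence of length at most $d'$ with sum in $G_{d/d'}$. For $d\in\mathcal{A}_i$ write $m_d=d/q_i^{\nu_{q_i}(d)}$ and let $k_d$ be the smallest non-negative integer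 such that $|S_d| < k_d\, m_d + \eta_{(m_d,d)}(G)$. -}

module Defs where

open import Level using (Level; _⊔_)
open import Algebra.Bundles using (AbelianGroup)
import Algebra.Definitions.RawMonoid as RM
open import Data.Nat as ℕ using (ℕ; zero; suc; _+_; _*_; _∸_; _^_; _≤_; _<_; _≟_; _<?_)
open import Data.Nat.DivMod using (_/_)
open import Data.Nat.Divisibility using (_∣_; _∣?_)
open import Data.Nat.Primality using (Prime; prime?)
open import Data.Integer using (+_)
open import Data.Rational as ℚ using (ℚ; 0ℚ)
open import Data.List using (List; []; _∷_; length; foldr; filter; upTo)
open import Data.List.Relation.Unary.All using (All)
open import Data.List.Relation.Unary.Any using (Any)
open import Data.List.Relation.Binary.Sublist.Propositional using (_⊆_)
open import Data.Nat.ListAction using () renaming (sum to sumℕ)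
open import Data.Product using (_×_; Σ; ∃-syntax)
open import Relation.Nullary using (Dec; yes; no; ¬_; ¬?; _×-dec_)
open import Relation.Unary using (Pred; Decidable)
open import Relation.Binary.PropositionalEquality using (_≡_; _≢_)

search : ∀ {p} {P : Pred ℕ p} → Decidable P → ℕ → ℕ → ℕ
search P? k zero = k
search P? k (suc f) with P? k
... | yes _ = k
... | no  _ = search P? (suc k) f

-- least j < B with P j (or B if there is none)
leastBelow : ∀ {p} {P : Pred ℕ p} → Decidable P → ℕ → ℕ
leastBelow P? B = search P? 0 B

-- d / d' (for d' ≥ 1; the value for d' = 0 is irrelevant)
div : ℕ → ℕ → ℕ
div d zero    = 0
div d (suc k) = d / suc k

-- ν_q(d): the largest e with q^e ∣ d, computed as the least e with ¬ q^(e+1) ∣ d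
-- (correct for q ≥ 2 and d ≥ 1, since then ν_q(d) < d).
ν : ℕ → ℕ → ℕ
ν q d = leastBelow (λ e → ¬? ((q ^ suc e) ∣? d)) d

-- P⁺(d): the largest prime divisor of d (correct for d ≥ 2),
-- computed as d ∸ j for the least j with d ∸ j prime and dividing d.
P⁺ : ℕ → ℕ
P⁺ d = d ∸ leastBelow (λ j → prime? (d ∸ j) ×-dec ((d ∸ j) ∣? d)) d

-- 𝒜_q = { d ∣ n : d > 1, P⁺(d) = q }   (q = q_i)
InA : ℕ → ℕ → ℕ → Set
InA n q d = (d ∣ n) × (1 < d) × (P⁺ d ≡ q)

InA? : ∀ n q → Decidable (InA n q)
InA? n q d = (d ∣? n) ×-dec ((1 <? d) ×-dec (P⁺ d ≟ q))

𝒜 : ℕ → ℕ → List ℕ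
𝒜 n q = filter (InA? n q) (upTo (suc n))

mPart : ℕ → ℕ → ℕ
mPart q d = div d (q ^ ν q d)

record FiniteAbelianGroup c ℓ : Set (Level.suc (c ⊔ ℓ)) where
  field
    abGroup  : AbelianGroup c ℓ
  open AbelianGroup abGroup public
  field
    _≈?_     : ∀ x y → Dec (x ≈ y)
    elems    : List Carrier
    complete : ∀ x → Any (x ≈_) elems

module FAG {c ℓ} (G : FiniteAbelianGroup c ℓ) where
  open FiniteAbelianGroup G public
  open RM rawMonoid public using () renaming (_×_ to _·_)

  sumG : List Carrier → Carrier
  sumG = foldr _∙_ ε

  InG : ℕ → Carrier → Set ℓ
  InG m x = (m · x) ≈ ε

  -- ord(g): least k ≥ 1 with k g = 0 (searching k ≤ length elems, which
  -- bounds |G| ≥ ord(g)); written as suc _ so that it is visibly nonzero.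
  ord-1 : Carrier → ℕ
  ord-1 g = leastBelow (λ k → (suc k · g) ≈? ε) (length elems)

  ord : Carrier → ℕ
  ord g = suc (ord-1 g)

  cross : List Carrier → ℚ
  cross = foldr (λ g r → ((+ 1) ℚ./ ord g) ℚ.+ r) 0ℚ

  HasTinyZS : List Carrier → Set (c ⊔ ℓ)
  HasTinyZS S = ∃[ T ] (T ⊆ S) × (T ≢ []) × (sumG T ≈ ε) × (cross T ℚ.≤ ℚ.1ℚ)

  IsExponent : ℕ → Set (c ⊔ ℓ)
  IsExponent n = (1 ≤ n) × (∀ x → InG n x)
               × (∀ m → 1 ≤ m → (∀ x → InG m x) → n ≤ m)

  -- t(H) for the subgroup H = {x : P x} of G: sequences over H are the
  -- sequences over G all of whose terms lie in H (sums, orders agree).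
  TinyProp : ∀ {p} → Pred Carrier p → ℕ → Set (c ⊔ ℓ ⊔ p)
  TinyProp P t = ∀ S → All P S → t ≤ length S → HasTinyZS S

  IsTinyThreshold : ∀ {p} → Pred Carrier p → ℕ → Set (c ⊔ ℓ ⊔ p)
  IsTinyThreshold P t = (1 ≤ t) × TinyProp P t
                      × (∀ t' → 1 ≤ t' → TinyProp P t' → t ≤ t')

  EtaProp : ℕ → ℕ → ℕ → Set (c ⊔ ℓ)
  EtaProp d' d t = ∀ S → All (InG d) S → t ≤ length S →
    ∃[ T ] (T ⊆ S) × (T ≢ []) × (length T ≤ d') × InG (div d d') (sumG T)

  IsEta : ℕ → ℕ → ℕ → Set (c ⊔ ℓ)
  IsEta d' d t = (1 ≤ t) × EtaProp d' d t
               × (∀ t' → 1 ≤ t' → EtaProp d' d t' → t ≤ t')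

  Sub : List Carrier → ℕ → List Carrier
  Sub S d = filter (λ g → ord g ≟ d) S

  -- k_d : least k ≥ 0 with |S_d| < k m_d + e   (e = η_{(m_d,d)}(G));
  -- the search bound |S_d| + 1 suffices since m_d ≥ 1.
  kVal : ℕ → ℕ → ℕ → ℕ
  kVal len m e = leastBelow (λ k → len <? k * m + e) (suc len)

  sumK : ℕ → List Carrier → (ℕ → ℕ → ℕ) → ℕ → ℕ
  sumK n S η q = sumℕ
    (Data.List.map (λ d → kVal (length (Sub S d)) (mPart q d) (η (mPart q d) d)) (𝒜 n q))

-- The terms of S of order d ∈ 𝒜_i are greedily split off into k_d disjoint blocks of at most
-- m_d terms each whose sums lie in G_{d/m_d} = G_{q^ν(d)}: by the definition of η, another
-- block can be extracted as long as η_{(m_d,d)} terms of order d remain.  All terms of a block T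
-- have order d, so k(T) = |T|/d ≤ m_d/d = 1/q^ν(d) ≤ 1/ord σ(T).  The Σ k_d block sums form a
-- sequence over G_{q^ν(n)}; were it of length ≥ t, it would have a tiny zero-sum subsequence, and
-- the union of the corresponding blocks would be a zero-sum subsequence of S whose cross number is
-- at most that of the chosen sums, i.e. a tiny zero-sum subsequence of S.

module Submission where

open import Defs
open import Level using (_⊔_)
open import Algebra.Bundles using (CommutativeMonoid)
import Algebra.Properties.Monoid.Mult as MonoidMult
import Algebra.Properties.Group as GroupProperties
open import Data.Fin using (toℕ)
open import Data.Fin.Properties using (pigeonhole; toℕ<n)
open import Data.Integer using (+_; +≤+) renaming (_≤_ to _≤ℤ_)
import Data.Integer.Properties as ℤ
open import Data.Integer.Solver using (module +-*-Solver)
open import Data.List using (List; []; _∷_; _++_; length; concat; map; foldr; filter; lookup; upTo)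
open import Data.List.Membership.Propositional.Properties using (∈-∃++)
open import Data.List.Properties using (++-assoc; map-++; concat-++; length-map; ++-identityʳ; length-++; ++-conicalˡ; foldr-map; map-cong-local; filter-reject; partition-defn)
open import Data.List.Relation.Binary.Permutation.Propositional
  using (_↭_; ↭-refl; ↭-sym; ↭-trans; ↭-reflexive; prep; swap; ↭⇒↭ₛ′; ↭ₛ⇒↭; module PermutationReasoning)
open import Data.List.Relation.Binary.Permutation.Propositional.Properties
  using (shift; shifts; drop-mid; ∈-resp-↭; ↭-length; ↭-empty-inv; ++⁺; ++⁺ʳ; All-resp-↭; map⁺)
import Data.List.Relation.Binary.Permutation.Setoid.Properties as SetoidPermutation
open import Data.List.Relation.Binary.Sublist.Propositional using (_⊆_; []; _∷_; _∷ʳ_; minimum; ⊆-reflexive)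
import Data.List.Relation.Binary.Sublist.Heterogeneous as Sublist
open import Data.List.Relation.Binary.Sublist.Propositional.Properties using (All-resp-⊆; concat⁺)
open import Data.List.Relation.Unary.All as All using (All; []; _∷_)
open import Data.List.Relation.Unary.All.Properties using (all-filter; ++⁻ʳ) renaming (map⁺ to All-map⁺; ++⁺ to All-++⁺)
open import Data.List.Relation.Unary.AllPairs using ([]; _∷_)
import Data.List.Relation.Unary.Any as Any
open import Data.List.Relation.Unary.Any using (here)
open import Data.List.Relation.Unary.Any.Properties using (lookup-index)
open import Data.List.Relation.Unary.Unique.Propositional using (Unique)
open import Data.List.Relation.Unary.Unique.Propositional.Properties using (filter⁺; upTo⁺)
open import Data.Nat using (ℕ; zero; suc; _+_; _*_; _∸_; _^_; _≤_; _<_; _≟_; _<?_; z≤n; s≤s; z<s; >-nonZero; nonTrivial⇒n>1)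
open import Data.Nat.DivMod using (_/_; m*n/n≡m; m*[n/m]≡n)
open import Data.Nat.Divisibility using (_∣_; divides; _∣?_; ∣-trans; ∣⇒≤; m∣m*n; 1∣_)
open import Data.Nat.ListAction using () renaming (sum to sumℕ)
open import Data.Nat.Primality using (Prime; prime⇒nonTrivial)
open import Data.Nat.Properties
open import Data.Product using (∃-syntax; _×_; _,_; proj₁; proj₂)
open import Data.Sum using (inj₁; inj₂)
open import Data.Rational as ℚ using (ℚ; toℚᵘ)
import Data.Rational.Properties as ℚ
open import Data.Rational.Unnormalised using (mkℚᵘ; *≡*; *≤*) renaming (_≃_ to _≃ᵘ_; _≤_ to _≤ᵘ_; _+_ to _+ᵘ_)
import Data.Rational.Unnormalised.Properties as ℚᵘ
open import Relation.Binary.Definitions using (DecidableEquality)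
open import Relation.Binary.PropositionalEquality as ≡ using (_≡_; _≢_; refl; sym; trans; cong; cong₂; subst; subst₂; module ≡-Reasoning)
open import Relation.Nullary using (yes; no; ¬_; contradiction)
open import Relation.Nullary.Decidable using (decidable-stable)
open import Relation.Unary using (Pred; Decidable)
open import Relation.Unary.Properties using (∁?)
open import Function using (_∘_)

module _ {a} {A : Set a} where

  infix 4 _⊑_

  _⊑_ : List A → List A → Set a
  xs ⊑ ys = ∃[ zs ] xs ++ zs ↭ ys

  ↭⇒⊑ : ∀ {xs ys} → xs ↭ ys → xs ⊑ ys
  ↭⇒⊑ {xs} p = [] , ↭-trans (↭-reflexive (++-identityʳ xs)) p

  ⊑-trans : ∀ {xs ys zs} → xs ⊑ ys → ys ⊑ zs → xs ⊑ zs
  ⊑-trans {xs} (us , p) (vs , q) =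
    us ++ vs , ↭-trans (↭-reflexive (sym (++-assoc xs us vs))) (↭-trans (++⁺ʳ vs p) q)

  ⊑-++⁺ : ∀ {xs ys us vs} → xs ⊑ ys → us ⊑ vs → xs ++ us ⊑ ys ++ vs
  ⊑-++⁺ {xs} {ys} {us} {vs} (zs , p) (ws , q) = zs ++ ws , (begin
    (xs ++ us) ++ zs ++ ws  ≡⟨ ++-assoc xs us (zs ++ ws) ⟩
    xs ++ us ++ zs ++ ws    ↭⟨ ++⁺ (↭-refl {x = xs}) (shifts us zs) ⟩
    xs ++ zs ++ us ++ ws    ≡⟨ ++-assoc xs zs (us ++ ws) ⟨
    (xs ++ zs) ++ us ++ ws  ↭⟨ ++⁺ p q ⟩
    ys ++ vs                ∎)
    where open PermutationReasoning

  ⊆⇒⊑ : ∀ {xs ys} → xs ⊆ ys → xs ⊑ ys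
  ⊆⇒⊑ [] = [] , ↭-refl
  ⊆⇒⊑ (_∷ʳ_ {xs = xs} y p) with zs , q ← ⊆⇒⊑ p = y ∷ zs , ↭-trans (shift y xs zs) (prep y q)
  ⊆⇒⊑ (refl ∷ p) with zs , q ← ⊆⇒⊑ p = zs , prep _ q

  ⊆-insert : ∀ (x : A) (ys zs : List A) {xs} → xs ⊆ ys ++ zs → ∃[ xs′ ] xs′ ⊆ ys ++ x ∷ zs × xs′ ↭ x ∷ xs
  ⊆-insert x [] zs {xs} p = x ∷ xs , refl ∷ p , ↭-refl
  ⊆-insert x (y ∷ ys) zs (.y ∷ʳ p) with xs′ , q , e ← ⊆-insert x ys zs p = xs′ , y ∷ʳ q , e
  ⊆-insert x (y ∷ ys) zs (refl ∷ p) with xs′ , q , e ← ⊆-insert x ys zs p =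
    y ∷ xs′ , refl ∷ q , ↭-trans (prep y e) (swap y x ↭-refl)

  ⊑⇒⊆↭ : ∀ {xs ys} → xs ⊑ ys → ∃[ xs′ ] xs′ ⊆ ys × xs′ ↭ xs
  ⊑⇒⊆↭ {[]} {ys} _ = [] , minimum ys , ↭-refl
  ⊑⇒⊆↭ {x ∷ xs} (zs , p) with ∈-∃++ (∈-resp-↭ p (here refl))
  ... | ys₁ , ys₂ , refl with ⊑⇒⊆↭ (zs , drop-mid [] ys₁ p)
  ... | xs′ , q , e with ⊆-insert x ys₁ ys₂ q
  ... | xs″ , q′ , e′ = xs″ , q′ , ↭-trans e′ (prep x e)

module _ {a b} {A : Set a} {B : Set b} where

  ⊆-map⁻ : ∀ (f : A → B) {ys xs} → ys ⊆ map f xs → ∃[ xs′ ] xs′ ⊆ xs × map f xs′ ≡ ys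
  ⊆-map⁻ f {xs = []} [] = [] , [] , refl
  ⊆-map⁻ f {xs = x ∷ xs} (_ ∷ʳ p) with xs′ , q , e ← ⊆-map⁻ f p = xs′ , x ∷ʳ q , e
  ⊆-map⁻ f {xs = x ∷ xs} (refl ∷ p) with xs′ , q , e ← ⊆-map⁻ f p = x ∷ xs′ , refl ∷ q , cong (f x ∷_) e

module _ {a p} {A : Set a} {P : Pred A p} (P? : Decidable P) where

  filter-++-filter-∁ : ∀ xs → filter P? xs ++ filter (∁? P?) xs ↭ xs
  filter-++-filter-∁ xs = ↭-sym (subst (λ (ys , zs) → xs ↭ ys ++ zs) (partition-defn P? xs)
                                       (↭ₛ⇒↭ (SetoidPermutation.partition-↭ (≡.setoid A) P? xs)))

module _ {a p q} {A : Set a} {P : Pred A p} {Q : Pred A q} (P? : Decidable P) (Q? : Decidable Q) where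

  filter-filter-∁ : (∀ {x} → P x → ¬ Q x) → ∀ xs → filter P? (filter (∁? Q?) xs) ≡ filter P? xs
  filter-filter-∁ P⇒¬Q [] = refl
  filter-filter-∁ P⇒¬Q (x ∷ xs) with Q? x
  ... | yes qx = trans (filter-filter-∁ P⇒¬Q xs) (sym (filter-reject P? (λ px → P⇒¬Q px qx)))
  ... | no _ with P? x
  ...   | yes _ = cong (x ∷_) (filter-filter-∁ P⇒¬Q xs)
  ...   | no _  = filter-filter-∁ P⇒¬Q xs

module _ {a b} {A : Set a} {B : Set b} (_≟ᴮ_ : DecidableEquality B) (key : A → B) where

  concat-fibres-⊑ : ∀ {ds} → Unique ds → ∀ xs → concat (map (λ d → filter (λ x → key x ≟ᴮ d) xs) ds) ⊑ xs
  concat-fibres-⊑ [] xs = xs , ↭-refl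
  concat-fibres-⊑ {d ∷ ds} (d∉ds ∷ unique-ds) xs =
    ⊑-trans (⊑-++⁺ (↭⇒⊑ ↭-refl) (subst (_⊑ others) same-fibres (concat-fibres-⊑ unique-ds others)))
            (↭⇒⊑ (filter-++-filter-∁ (λ x → key x ≟ᴮ d) xs))
    where
    others : List A
    others = filter (∁? (λ x → key x ≟ᴮ d)) xs
    same-fibres : concat (map (λ d′ → filter (λ x → key x ≟ᴮ d′) others) ds)
                ≡ concat (map (λ d′ → filter (λ x → key x ≟ᴮ d′) xs) ds)
    same-fibres = cong concat (map-cong-local (All.map
      (λ d≢d′ → filter-filter-∁ (λ x → key x ≟ᴮ _) (λ x → key x ≟ᴮ d) (λ k≡d′ k≡d → d≢d′ (trans (sym k≡d) k≡d′)) xs) d∉ds))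

module _ {p} {P : Pred ℕ p} (P? : Decidable P) where

  search-minimal : ∀ k f {j} → k ≤ j → j < search P? k f → ¬ P j
  search-minimal k zero k≤j j<k = contradiction k≤j (<⇒≱ j<k)
  search-minimal k (suc f) k≤j j<r with P? k
  ... | yes _ = contradiction k≤j (<⇒≱ j<r)
  ... | no ¬pk with m≤n⇒m<n∨m≡n k≤j
  ...   | inj₁ k<j = search-minimal (suc k) f k<j j<r
  ...   | inj₂ refl = ¬pk

  search-satisfies : ∀ k f → search P? k f < k + f → P (search P? k f)
  search-satisfies k zero r<k = contradiction (sym (+-identityʳ k)) (<⇒≢ r<k)
  search-satisfies k (suc f) r<k+f with P? k
  ... | yes pk = pk
  ... | no _ = search-satisfies (suc k) f (subst (search P? (suc k) f <_) (+-suc k f) r<k+f)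

  leastBelow-minimal : ∀ B {j} → j < leastBelow P? B → ¬ P j
  leastBelow-minimal B = search-minimal 0 B z≤n

  leastBelow-satisfies : ∀ B → leastBelow P? B < B → P (leastBelow P? B)
  leastBelow-satisfies = search-satisfies 0

  leastBelow-≤ : ∀ B {j} → P j → leastBelow P? B ≤ j
  leastBelow-≤ B pj = ≮⇒≥ (λ j<r → leastBelow-minimal B j<r pj)

n<2^n : ∀ n → n < 2 ^ n
n<2^n zero = z<s
n<2^n (suc n) = +-mono-≤ (m^n>0 2 n) (≤-trans (n<2^n n) (m≤m+n (2 ^ n) 0))

^-monoʳ-∣ : ∀ q {a b} → a ≤ b → q ^ a ∣ q ^ b
^-monoʳ-∣ q {a} a≤b with k , refl ← m≤n⇒∃[o]m+o≡n a≤b =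
  subst (q ^ a ∣_) (sym (^-distribˡ-+-* q a k)) (m∣m*n (q ^ k))

q^ν∣ : ∀ q d → q ^ ν q d ∣ d
q^ν∣ q d = go (ν q d) (leastBelow-minimal _ d)
  where
  go : ∀ r → (∀ {j} → j < r → ¬ ¬ (q ^ suc j ∣ d)) → q ^ r ∣ d
  go zero _ = 1∣ d
  go (suc j) below = decidable-stable (q ^ suc j ∣? d) (below ≤-refl)

-- ν q d is a search below d; if it is exhausted, e < q ^ e ≤ d bounds e instead.
^∣⇒≤ν : ∀ {q d e} → 2 ≤ q → 1 ≤ d → q ^ e ∣ d → e ≤ ν q d
^∣⇒≤ν {q} {d} {e} 2≤q 1≤d qᵉ∣d with ν q d <? d
... | yes ν<d = ≮⇒≥ (λ ν<e → leastBelow-satisfies _ d ν<d (∣-trans (^-monoʳ-∣ q ν<e) qᵉ∣d))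
... | no ν≮d = ≤-trans (<⇒≤ e<d) (≮⇒≥ ν≮d)
  where
  e<d : e < d
  e<d = <-≤-trans (n<2^n e) (≤-trans (^-monoˡ-≤ e 2≤q) (∣⇒≤ {{>-nonZero 1≤d}} qᵉ∣d))

div-*ʳ : ∀ c {Q} → 1 ≤ Q → div (c * Q) Q ≡ c
div-*ʳ c {suc _} _ = m*n/n≡m c _

div-*ˡ : ∀ {c} Q → 1 ≤ c → div (c * Q) c ≡ Q
div-*ˡ {suc c} Q _ = trans (cong (_/ suc c) (*-comm (suc c) Q)) (m*n/n≡m Q (suc c))

*-div-∣ : ∀ {m d} → 1 ≤ d → m ∣ d → m * div d m ≡ d
*-div-∣ {zero} 1≤d (divides k d≡k*0) = contradiction (sym (trans d≡k*0 (*-zeroʳ k))) (<⇒≢ 1≤d)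
*-div-∣ {suc m} _ m∣d = m*[n/m]≡n m∣d

div>0 : ∀ {m d} → 1 ≤ d → m ∣ d → 1 ≤ div d m
div>0 {m} {d} 1≤d m∣d = n≢0⇒n>0 λ q≡0 →
  <⇒≢ 1≤d (sym (trans (sym (*-div-∣ 1≤d m∣d)) (trans (cong (m *_) q≡0) (*-zeroʳ m))))

mPart-factors : ∀ {q d} → 1 ≤ q → 1 ≤ d → mPart q d ∣ d × div d (mPart q d) ≡ q ^ ν q d
mPart-factors {q} {d} 1≤q 1≤d with q^ν∣ q d
... | divides zero d≡0 = contradiction (sym d≡0) (<⇒≢ 1≤d)
... | divides (suc c) d≡cQ = subst (λ m → m ∣ d × div d m ≡ Q) (sym mPart≡c) (c∣d , div-*-cancel)
  where
  Q = q ^ ν q d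
  mPart≡c : mPart q d ≡ suc c
  mPart≡c = trans (cong (λ x → div x Q) d≡cQ) (div-*ʳ (suc c) (m^n>0 q {{>-nonZero 1≤q}} (ν q d)))
  c∣d : suc c ∣ d
  c∣d = divides Q (trans d≡cQ (*-comm (suc c) Q))
  div-*-cancel : div d (suc c) ≡ Q
  div-*-cancel = trans (cong (λ x → div x (suc c)) d≡cQ) (div-*ˡ Q z<s)

1/d+k/d≃[1+k]/d : ∀ k d₀ → mkℚᵘ (+ 1) d₀ +ᵘ mkℚᵘ (+ k) d₀ ≃ᵘ mkℚᵘ (+ suc k) d₀
1/d+k/d≃[1+k]/d k d₀ = *≡* (solve 2 (λ K D → (con (+ 1) :* D :+ K :* D) :* D := (con (+ 1) :+ K) :* (D :* D))
                                   refl (+ k) (+ suc d₀))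
  where open +-*-Solver

k/d≤1/o : ∀ {k d₀ o₀} → k * suc o₀ ≤ suc d₀ → mkℚᵘ (+ k) d₀ ≤ᵘ mkℚᵘ (+ 1) o₀
k/d≤1/o {k} {d₀} {o₀} ko≤d = *≤* (subst₂ _≤ℤ_ (ℤ.pos-* k (suc o₀)) (sym (ℤ.*-identityˡ (+ suc d₀))) (+≤+ ko≤d))

module FoldrCommutativeMonoid {c ℓ} (M : CommutativeMonoid c ℓ) where
  open CommutativeMonoid M using (_≈_; _∙_; ε; setoid; isEquivalence; isCommutativeMonoid; identityˡ; assoc; ∙-congˡ)
  private module M = CommutativeMonoid M

  foldr-++ : ∀ xs ys → foldr _∙_ ε (xs ++ ys) ≈ foldr _∙_ ε xs ∙ foldr _∙_ ε ys
  foldr-++ [] ys = M.sym (identityˡ _)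
  foldr-++ (x ∷ xs) ys = M.trans (∙-congˡ (foldr-++ xs ys)) (M.sym (assoc x _ _))

  foldr-concat : ∀ xss → foldr _∙_ ε (concat xss) ≈ foldr _∙_ ε (map (foldr _∙_ ε) xss)
  foldr-concat [] = M.refl
  foldr-concat (xs ∷ xss) = M.trans (foldr-++ xs (concat xss)) (∙-congˡ (foldr-concat xss))

  foldr-↭ : ∀ {xs ys} → xs ↭ ys → foldr _∙_ ε xs ≈ foldr _∙_ ε ys
  foldr-↭ p = SetoidPermutation.foldr-commMonoid setoid isCommutativeMonoid (↭⇒↭ₛ′ isEquivalence p)

module FiniteAbelianGroupProperties {c ℓ} (G : FiniteAbelianGroup c ℓ) where
  open FAG G hiding (refl; sym; trans; reflexive)
  private module ≈ = FAG G
  open MonoidMult monoid using (×-homo-+; ×-assocˡ; ×-congʳ)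
  open GroupProperties group using (identityʳ-unique)
  open FoldrCommutativeMonoid commutativeMonoid public
    using () renaming (foldr-++ to sumG-++; foldr-concat to sumG-concat; foldr-↭ to sumG-↭)
  private module Σℚ = FoldrCommutativeMonoid ℚ.+-0-commutativeMonoid

  1/ord : Carrier → ℚ
  1/ord g = (+ 1) ℚ./ ord g

  cross≡sum : ∀ T → cross T ≡ foldr ℚ._+_ ℚ.0ℚ (map 1/ord T)
  cross≡sum T = sym (foldr-map ℚ._+_ 1/ord ℚ.0ℚ T)

  cross-++ : ∀ T U → cross (T ++ U) ≡ cross T ℚ.+ cross U
  cross-++ T U = begin
    cross (T ++ U)                                                   ≡⟨ cross≡sum (T ++ U) ⟩
    foldr ℚ._+_ ℚ.0ℚ (map 1/ord (T ++ U))                            ≡⟨ cong (foldr ℚ._+_ ℚ.0ℚ) (map-++ 1/ord T U) ⟩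
    foldr ℚ._+_ ℚ.0ℚ (map 1/ord T ++ map 1/ord U)                    ≡⟨ Σℚ.foldr-++ (map 1/ord T) (map 1/ord U) ⟩
    foldr ℚ._+_ ℚ.0ℚ (map 1/ord T) ℚ.+ foldr ℚ._+_ ℚ.0ℚ (map 1/ord U) ≡⟨ cong₂ ℚ._+_ (cross≡sum T) (cross≡sum U) ⟨
    cross T ℚ.+ cross U                                              ∎
    where open ≡-Reasoning

  cross-↭ : ∀ {T U} → T ↭ U → cross T ≡ cross U
  cross-↭ {T} {U} p = trans (cross≡sum T) (trans (Σℚ.foldr-↭ (map⁺ 1/ord p)) (sym (cross≡sum U)))

  ×-ε : ∀ k → (k · ε) ≈ ε
  ×-ε zero = ≈.refl
  ×-ε (suc k) = ≈.trans (identityˡ _) (×-ε k)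

  InG-∣ : ∀ {a b x} → a ∣ b → InG a x → InG b x
  InG-∣ {a} {x = x} (divides k refl) ax≈ε = ≈.trans (≈.sym (×-assocˡ x k a)) (≈.trans (×-congʳ k ax≈ε) (×-ε k))

  ord-≤ : ∀ {x k} → 1 ≤ k → InG k x → ord x ≤ k
  ord-≤ {x} {suc k} _ kx≈ε = s≤s (leastBelow-≤ (λ j → (suc j · x) ≈? ε) (length elems) kx≈ε)

  multiples-repeat : ∀ x → ∃[ a ] ∃[ b ] a < b × b ≤ length elems × (a · x) ≈ (b · x)
  multiples-repeat x with pigeonhole (n<1+n (length elems)) (λ i → Any.index (complete (toℕ i · x)))
  ... | i , j , i<j , same-index = toℕ i , toℕ j , i<j , ≤-pred (toℕ<n j) ,
    ≈.trans (lookup-index (complete _)) (≈.trans (≈.reflexive (cong (lookup elems) same-index))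
                                                 (≈.sym (lookup-index (complete _))))

  vanishing-multiple : ∀ x → ∃[ k ] k < length elems × InG (suc k) x
  vanishing-multiple x with multiples-repeat x
  ... | a , b , a<b , b≤L , ax≈bx with k , 1+a+k≡b ← m≤n⇒∃[o]m+o≡n a<b =
    k , ≤-trans (≤-trans (m≤n+m (suc k) a) (≤-reflexive a+[1+k]≡b)) b≤L ,
    identityʳ-unique (a · x) (suc k · x)
      (≈.trans (≈.sym (×-homo-+ x a (suc k))) (≈.trans (≈.reflexive (cong (_· x) a+[1+k]≡b)) (≈.sym ax≈bx)))
    where
    a+[1+k]≡b : a + suc k ≡ b
    a+[1+k]≡b = trans (+-suc a k) 1+a+k≡b

  InG-ord : ∀ x → InG (ord x) x
  InG-ord x with k , k<L , kx≈ε ← vanishing-multiple x =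
    leastBelow-satisfies _ (length elems) (≤-<-trans (leastBelow-≤ _ (length elems) kx≈ε) k<L)

  cross-uniform : ∀ {d₀} T → All (λ g → ord g ≡ suc d₀) T → toℚᵘ (cross T) ≃ᵘ mkℚᵘ (+ length T) d₀
  cross-uniform [] [] = *≡* refl
  cross-uniform (g ∷ T) (refl ∷ ords) =
    ℚᵘ.≃-trans (ℚ.toℚᵘ-homo-+ (1/ord g) (cross T))
      (ℚᵘ.≃-trans (ℚᵘ.+-cong (ℚ.toℚᵘ-fromℚᵘ (mkℚᵘ (+ 1) (ord-1 g))) (cross-uniform T ords))
        (1/d+k/d≃[1+k]/d (length T) (ord-1 g)))

  cross-≤ : ∀ {d₀} x T → All (λ g → ord g ≡ suc d₀) T → length T * ord x ≤ suc d₀ → cross T ℚ.≤ 1/ord x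
  cross-≤ x T ords bound = ℚ.toℚᵘ-cancel-≤
    (ℚᵘ.≤-respʳ-≃ (ℚᵘ.≃-sym (ℚ.toℚᵘ-fromℚᵘ (mkℚᵘ (+ 1) (ord-1 x))))
      (ℚᵘ.≤-respˡ-≃ (ℚᵘ.≃-sym (cross-uniform T ords)) (k/d≤1/o bound)))

  record Block {p} (P : Pred Carrier p) (T : List Carrier) : Set (c ⊔ ℓ ⊔ p) where
    field
      nonEmpty : T ≢ []
      cross≤   : cross T ℚ.≤ 1/ord (sumG T)
      sum∈     : P (sumG T)

  record Decomposition {p} (P : Pred Carrier p) (S : List Carrier) (k : ℕ) : Set (c ⊔ ℓ ⊔ p) where
    field
      blocks    : List (List Carrier)
      blocks⊑   : concat blocks ⊑ S
      allBlocks : All (Block P) blocks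
      #blocks   : length blocks ≡ k

  module _ {p} {P : Pred Carrier p} where

    decomposition-[] : ∀ {S} → Decomposition P S 0
    decomposition-[] {S} = record { blocks = [] ; blocks⊑ = S , ↭-refl ; allBlocks = [] ; #blocks = refl }

    decomposition-block : ∀ {T} → Block P T → Decomposition P T 1
    decomposition-block {T} block = record
      { blocks = T ∷ [] ; blocks⊑ = ↭⇒⊑ (↭-reflexive (++-identityʳ T)) ; allBlocks = block ∷ [] ; #blocks = refl }

    decomposition-++ : ∀ {S U k l} → Decomposition P S k → Decomposition P U l → Decomposition P (S ++ U) (k + l)
    decomposition-++ D E = record
      { blocks    = D.blocks ++ E.blocks
      ; blocks⊑   = subst (_⊑ _) (concat-++ D.blocks E.blocks) (⊑-++⁺ D.blocks⊑ E.blocks⊑)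
      ; allBlocks = All-++⁺ D.allBlocks E.allBlocks
      ; #blocks   = trans (length-++ D.blocks) (cong₂ _+_ D.#blocks E.#blocks)
      }
      where
      module D = Decomposition D
      module E = Decomposition E

    decomposition-⊑ : ∀ {S U k} → S ⊑ U → Decomposition P S k → Decomposition P U k
    decomposition-⊑ S⊑U D = record { Decomposition D ; blocks⊑ = ⊑-trans (Decomposition.blocks⊑ D) S⊑U }

    decomposition-concat : ∀ {I : Set} (Xs : I → List Carrier) (K : I → ℕ) ds →
                           All (λ d → Decomposition P (Xs d) (K d)) ds →
                           Decomposition P (concat (map Xs ds)) (sumℕ (map K ds))
    decomposition-concat Xs K [] [] = decomposition-[]
    decomposition-concat Xs K (d ∷ ds) (D ∷ Ds) = decomposition-++ D (decomposition-concat Xs K ds Ds)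

  decomposition-map : ∀ {p q} {P : Pred Carrier p} {Q : Pred Carrier q} {S k} →
                      (∀ {x} → P x → Q x) → Decomposition P S k → Decomposition Q S k
  decomposition-map P⇒Q D = record
    { Decomposition D ; allBlocks = All.map (λ b → record { Block b ; sum∈ = P⇒Q (Block.sum∈ b) }) (Decomposition.allBlocks D) }

  module _ {p} {P : Pred Carrier p} where

    cross-concat-≤ : ∀ Ts → All (Block P) Ts → cross (concat Ts) ℚ.≤ cross (map sumG Ts)
    cross-concat-≤ [] [] = ℚ.≤-refl
    cross-concat-≤ (T ∷ Ts) (block ∷ blocks) = subst (ℚ._≤ cross (map sumG (T ∷ Ts))) (sym (cross-++ T (concat Ts)))
      (ℚ.+-mono-≤ (Block.cross≤ block) (cross-concat-≤ Ts blocks))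

    concat-blocks≡[]⇒≡[] : ∀ {Ts} → All (Block P) Ts → concat Ts ≡ [] → Ts ≡ []
    concat-blocks≡[]⇒≡[] [] _ = refl
    concat-blocks≡[]⇒≡[] {T ∷ Ts} (block ∷ _) eq = contradiction (++-conicalˡ T (concat Ts) eq) (Block.nonEmpty block)

    HasTinyZS-sums⇒HasTinyZS : ∀ {S k} (D : Decomposition P S k) →
                               HasTinyZS (map sumG (Decomposition.blocks D)) → HasTinyZS S
    HasTinyZS-sums⇒HasTinyZS D (V , V⊆ , V≢[] , ΣV≈ε , crossV≤1)
      with Ts , Ts⊆ , sums≡V ← ⊆-map⁻ sumG V⊆
      with W , W⊆S , W↭ ← ⊑⇒⊆↭ (⊑-trans (⊆⇒⊑ (concat⁺ (Sublist.map ⊆-reflexive Ts⊆))) (Decomposition.blocks⊑ D)) =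
      W , W⊆S , W≢[] , ΣW≈ε , crossW≤1
      where
      module D = Decomposition D
      blocks : All (Block P) Ts
      blocks = All-resp-⊆ Ts⊆ D.allBlocks
      W≢[] : W ≢ []
      W≢[] refl = V≢[] (trans (sym sums≡V) (cong (map sumG) (concat-blocks≡[]⇒≡[] blocks (↭-empty-inv (↭-sym W↭)))))
      ΣW≈ε : sumG W ≈ ε
      ΣW≈ε = ≈.trans (sumG-↭ W↭) (≈.trans (sumG-concat Ts) (≈.trans (≈.reflexive (cong sumG sums≡V)) ΣV≈ε))
      crossW≤1 : cross W ℚ.≤ ℚ.1ℚ
      crossW≤1 = subst (ℚ._≤ ℚ.1ℚ) (sym (cross-↭ W↭))
        (ℚ.≤-trans (cross-concat-≤ Ts blocks) (subst (ℚ._≤ ℚ.1ℚ) (sym (cong cross sums≡V)) crossV≤1))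

    decomposition-<-threshold : ∀ {S k t} → ¬ HasTinyZS S → TinyProp P t → Decomposition P S k → k < t
    decomposition-<-threshold noTiny tiny D = ≰⇒> λ t≤k → noTiny (HasTinyZS-sums⇒HasTinyZS D
      (tiny (map sumG D.blocks) (All-map⁺ (All.map Block.sum∈ D.allBlocks))
            (≤-trans t≤k (≤-reflexive (trans (sym D.#blocks) (sym (length-map sumG D.blocks)))))))
      where module D = Decomposition D

  -- k(T) = |T|/d, and |T| · ord σ(T) ≤ m · (d/m) = d.
  block-of-order : ∀ {d m T} → m ∣ d → All (λ g → ord g ≡ d) T → T ≢ [] → length T ≤ m →
                   InG (div d m) (sumG T) → Block (InG (div d m)) T
  block-of-order {T = []} _ _ T≢[] = contradiction refl T≢[]
  block-of-order {m = m} {T = g ∷ T} m∣d ords@(refl ∷ _) T≢[] |T|≤m ΣT∈ = record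
    { nonEmpty = T≢[]
    ; cross≤   = cross-≤ (sumG (g ∷ T)) (g ∷ T) ords
                   (≤-trans (*-mono-≤ |T|≤m (ord-≤ (div>0 z<s m∣d) ΣT∈)) (≤-reflexive (*-div-∣ z<s m∣d)))
    ; sum∈     = ΣT∈
    }

  module _ {d m e : ℕ} (m∣d : m ∣ d) (eta : EtaProp m d e) where

    OfOrder : List Carrier → Set c
    OfOrder = All (λ g → ord g ≡ d)

    record BlockSplit (R : List Carrier) : Set (c ⊔ ℓ) where
      field
        block       : List Carrier
        rest        : List Carrier
        split       : block ++ rest ↭ R
        isBlock     : Block (InG (div d m)) block
        restOfOrder : OfOrder rest
        |R|≤m+|rest| : length R ≤ m + length rest

    extract-block : ∀ R → OfOrder R → e ≤ length R → BlockSplit R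
    extract-block R ords e≤|R| with eta R (All.map (λ ord≡d → subst (λ k → InG k _) ord≡d (InG-ord _)) ords) e≤|R|
    ... | T , T⊆R , T≢[] , |T|≤m , ΣT∈ with C , T++C↭R ← ⊆⇒⊑ T⊆R = record
      { block        = T
      ; rest         = C
      ; split        = T++C↭R
      ; isBlock      = block-of-order m∣d (All-resp-⊆ T⊆R ords) T≢[] |T|≤m ΣT∈
      ; restOfOrder  = ++⁻ʳ T (All-resp-↭ (↭-sym T++C↭R) ords)
      ; |R|≤m+|rest| = ≤-trans (≤-reflexive (trans (sym (↭-length T++C↭R)) (length-++ T))) (+-monoˡ-≤ (length C) |T|≤m)
      }

    extract : ∀ K R → OfOrder R → (∀ {j} → j < K → j * m + e ≤ length R) → Decomposition (InG (div d m)) R K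
    extract zero R _ _ = decomposition-[]
    extract (suc K) R ords enough =
      decomposition-⊑ (↭⇒⊑ split) (decomposition-++ (decomposition-block isBlock) (extract K rest restOfOrder enough′))
      where
      open BlockSplit (extract-block R ords (enough z<s))
      enough′ : ∀ {j} → j < K → j * m + e ≤ length rest
      enough′ {j} j<K = +-cancelˡ-≤ m _ _ (begin
        m + (j * m + e)  ≡⟨ +-assoc m (j * m) e ⟨
        suc j * m + e    ≤⟨ enough (s≤s j<K) ⟩
        length R         ≤⟨ |R|≤m+|rest| ⟩
        m + length rest  ∎)
        where open ≤-Reasoning

    decomposition-kVal : ∀ R → OfOrder R → Decomposition (InG (div d m)) R (kVal (length R) m e)
    decomposition-kVal R ords = extract (kVal (length R) m e) R ords
      (λ j<K → ≮⇒≥ (leastBelow-minimal (λ k → length R <? k * m + e) (suc (length R)) j<K))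

  module _ {n q} {η : ℕ → ℕ → ℕ} (1≤n : 1 ≤ n) (2≤q : 2 ≤ q)
           (ηok : ∀ d′ d → d′ ∣ d → d ∣ n → IsEta d′ d (η d′ d)) where

    kOrder : List Carrier → ℕ → ℕ
    kOrder S d = kVal (length (Sub S d)) (mPart q d) (η (mPart q d) d)

    decomposition-Sub : ∀ S {d} → d ∣ n → 1 ≤ d → Decomposition (InG (q ^ ν q n)) (Sub S d) (kOrder S d)
    decomposition-Sub S {d} d∣n 1≤d =
      decomposition-map (λ {x} → InG-∣ q^νd∣q^νn ∘ subst (λ k → InG k x) d/m≡q^ν)
        (decomposition-kVal m∣d (proj₁ (proj₂ (ηok (mPart q d) d m∣d d∣n))) (Sub S d) (all-filter (λ g → ord g ≟ d) S))
      where
      m∣d = proj₁ (mPart-factors (<⇒≤ 2≤q) 1≤d)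
      d/m≡q^ν = proj₂ (mPart-factors (<⇒≤ 2≤q) 1≤d)
      q^νd∣q^νn : q ^ ν q d ∣ q ^ ν q n
      q^νd∣q^νn = ^-monoʳ-∣ q {ν q d} (^∣⇒≤ν 2≤q 1≤n (∣-trans (q^ν∣ q d) d∣n))

    decomposition-divisors : ∀ S {ds} → Unique ds → All (λ d → d ∣ n × 1 ≤ d) ds →
                             Decomposition (InG (q ^ ν q n)) S (sumℕ (map (kOrder S) ds))
    decomposition-divisors S {ds} unique divisors =
      decomposition-⊑ (concat-fibres-⊑ _≟_ ord unique S)
        (decomposition-concat (Sub S) (kOrder S) ds (All.map (λ (d∣n , 1≤d) → decomposition-Sub S d∣n 1≤d) divisors))

lemma13 : ∀ {c ℓ} (G : FiniteAbelianGroup c ℓ) (n : ℕ) →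
          FAG.IsExponent G n →
          (S : List (FAG.Carrier G)) → ¬ FAG.HasTinyZS G S →
          (η : ℕ → ℕ → ℕ) →
          (∀ d' d → d' ∣ d → d ∣ n → FAG.IsEta G d' d (η d' d)) →
          (q : ℕ) → Prime q → q ∣ n →
          (t : ℕ) → FAG.IsTinyThreshold G (FAG.InG G (q ^ ν q n)) t →
          FAG.sumK G n S η q ≤ t ∸ 1
lemma13 G n (1≤n , _) S noTiny η ηok q q-prime _ t (_ , tiny , _) =
  ∸-monoˡ-≤ 1 (decomposition-<-threshold noTiny tiny
    (decomposition-divisors 1≤n 2≤q ηok S (filter⁺ (InA? n q) (upTo⁺ (suc n)))
      (All.map (λ (d∣n , 1<d , _) → d∣n , <⇒≤ 1<d) (all-filter (InA? n q) (upTo (suc n))))))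
  where
  open FiniteAbelianGroupProperties G
  2≤q : 2 ≤ q
  2≤q = nonTrivial⇒n>1 q {{prime⇒nonTrivial q-prime}}
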